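{- Let $G$ be a weighted game arena with partial observation and $\ell_{\max}\in\mathbb{N}_0$. If Eve wins the safety game on $G'$ (avoiding $\mathcal{U}$), then Eve has a winning observation-based strategy in $G$ for the objective $\mathsf{DirFix}(\ell_{\max})$.
   Context: A WGA is $G=\langle Q,q_I,\Sigma,\Delta,w,Obs\rangle$: $Q$ finite set of states, $q_I\in Q$, $\Sigma$ finite set of actions, $\Delta\subseteq Q\times\Sigma\times Q$ total transition relation, $w:\Delta\to\mathbb{Z}$, $Obs$ a partition of $Q$ with $\{q_I\}\in Obs$; $W=\max\{|w(t)|:t\in\Delta\}$; $\mathrm{post}_\sigma(s)=\{q':\exists q\in s,(q,\sigma,q')\in\Delta\}$. Concrete paths are sequences $q_0\sigma_0q_1\dots$ with $(q_i,\sigma_i,q_{i+1})\in\Delta$; abstract paths are sequences $o_0\sigma_0o_1\dots$ of observations and actions realized by some concrete path with $q_i\in o_i$; $\gamma(\psi)$ is the set of concrete paths with the same actions and $q_i\in o_i$. For concrete $\chi$, $w(\chi[k..l])=\sum_{i=k}^{l-1}w(q_i,\sigma_i,q_{i+1})$. A play is an infinite abstract path starting with $\{q_I\}$. An observation-based strategy for Eve maps finite play prefixes $o_0\sigma_0\dots o_n$ to actions; consistency and winning are as usual (all consistent plays lie in the objective). $\mathbb{N}_0=\{1,2,\dots\}$. For concrete $\chi$, $i\ge0$, $\ell\in\mathbb{N}_0$: $\chi\in\mathsf{GW}(i,\ell)$ iff some $1\le j\le\ell$ has $w(\chi[i..i+j])\ge0$; $\mathsf{DirFix}(\ell)$ is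 the set of plays $\psi$ with $\pi\in\mathsf{GW}(i,\ell)$ for all $\pi\in\gamma(\psi)$ and $i\ge0$. Construction of $G'$: $\mathcal{F}$ is the set of all functions $f:Q\to(\{1,\dots,\ell_{\max}\}\to\{ -W\ell_{\max},\dots,0\})\cup\{\bot\}$; $\mathrm{supp}(f)=\{q:f(q)\ne\bot\}$, $f(q)_i=f(q)(i)$. $f_I(q_I)_i=0$ for all $i$ and $f_I(q)=\bot$ for $q\ne q_I$. For $\sigma\in\Sigma$, $f_2$ is a $\sigma$-successor of $f_1$ if $\mathrm{supp}(f_2)=\mathrm{post}_\sigma(\mathrm{supp}(f_1))\cap o$ for some $o\in Obs$ and for all $q\in\mathrm{supp}(f_2)$, $1\le j\le\ell_{\max}$: $f_2(q)_j=\max\{ -W\ell_{\max},\min\{0,\zeta_j(q)\}\}$ with $\zeta_1(q)=\min\{w(p,\sigma,q):p\in\mathrm{supp}(f_1),(p,\sigma,q)\in\Delta\}$ and, for $j\ge2$, $\zeta_j(q)=\min\{f_1(p)_{j-1}+w(p,\sigma,q):p\in\mathrm{supp}(f_1),(p,\sigma,q)\in\Delta,f_1(p)_{j-1}<0\}$ ($\min\emptyset=+\infty$). $G'$ is the perfect-information game arena with positions $\mathcal{F}$, initial position $f_I$, and transitions $(f_1,\sigma,f_2)$ whenever $f_2$ is a $\sigma$-successor of $f_1$: in each round Eve picks $\sigma$ (as a function of the full history $f_0\sigma_0\dots f_n$) and Adam picks any $\sigma$-successor. Let $\mathcal{U}=\{f\in\mathcal{F}:\exists q\in\mathrm{supp}(f),f(q)_{\ell_{\max}}<0\}$.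 Eve wins the safety game on $G'$ if she has a strategy such that every consistent play from $f_I$ never visits $\mathcal{U}$. -}

module Defs where

open import Data.Nat as ℕ using (ℕ; zero; suc; _⊔_; _≤_)
open import Data.Integer as ℤ using (ℤ; +_; -_; ∣_∣) renaming (_+_ to _+ℤ_; _⊓_ to _⊓ℤ_; _⊔_ to _⊔ℤ_; _<_ to _<ℤ_; _≥_ to _≥ℤ_)
open import Data.Fin using (Fin; zero; suc; inject₁; _≟_)
open import Data.Bool using (Bool; true; false; if_then_else_; _∧_)
open import Data.Maybe using (Maybe; just; nothing; is-just)
open import Data.List using (List; []; _∷_; map; foldr; allFin; concatMap; upTo)
open import Data.Vec using (Vec; lookup; tabulate; replicate; last)
open import Data.Product using (Σ; ∃; _×_; _,_)
open import Relation.Nullary using (¬_; does)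
open import Relation.Binary.PropositionalEquality using (_≡_)

-- States are Fin nQ, actions Fin nA, observations are the classes of a
-- surjective labelling obs : Fin nQ → Fin nO (a partition of Q).
-- The transition relation Δ is a Boolean-valued (decidable) relation;
-- the weight function is given on all triples, only its values on Δ matter.

record WGA : Set where
  field
    nQ nA nO : ℕ
    qI       : Fin nQ
    Δ        : Fin nQ → Fin nA → Fin nQ → Bool
    w        : Fin nQ → Fin nA → Fin nQ → ℤ
    obs      : Fin nQ → Fin nO
    total    : ∀ q σ → ∃ λ q′ → Δ q σ q′ ≡ true
    obs-surj : ∀ o → ∃ λ q → obs q ≡ o
    qI-alone : ∀ q → obs q ≡ obs qI → q ≡ qI

module _ (G : WGA) where
  open WGA G

  maxW : ℕ
  maxW = foldr _⊔_ 0
           (concatMap (λ q → concatMap (λ σ → concatMap (λ q′ →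
              if Δ q σ q′ then ∣ w q σ q′ ∣ ∷ [] else []) (allFin nQ)) (allFin nA)) (allFin nQ))

  History : Set → Set → Set
  History X A = List (X × A) × X

  prefix : {X A : Set} → (ℕ → X) → (ℕ → A) → ℕ → History X A
  prefix x a n = map (λ i → x i , a i) (upTo n) , x n

  IsConcretePath : (ℕ → Fin nQ) → (ℕ → Fin nA) → Set
  IsConcretePath q σ = ∀ i → Δ (q i) (σ i) (q (suc i)) ≡ true

  InConcretisation : (ℕ → Fin nQ) → (ℕ → Fin nO) → (ℕ → Fin nA) → Set
  InConcretisation q o σ = IsConcretePath q σ × (∀ i → obs (q i) ≡ o i)

  segWeight : (ℕ → Fin nQ) → (ℕ → Fin nA) → ℕ → ℕ → ℤ
  segWeight q σ i zero    = + 0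
  segWeight q σ i (suc j) = segWeight q σ i j +ℤ w (q (i ℕ.+ j)) (σ (i ℕ.+ j)) (q (suc (i ℕ.+ j)))

  GW : (ℕ → Fin nQ) → (ℕ → Fin nA) → ℕ → ℕ → Set
  GW q σ i ℓ = ∃ λ j → 1 ≤ j × j ≤ ℓ × segWeight q σ i j ≥ℤ + 0

  DirFix : ℕ → (ℕ → Fin nO) → (ℕ → Fin nA) → Set
  DirFix ℓ o σ = ∀ q → InConcretisation q o σ → ∀ i → GW q σ i ℓ

  IsPlay : (ℕ → Fin nO) → (ℕ → Fin nA) → Set
  IsPlay o σ = o 0 ≡ obs qI × ∃ λ q → InConcretisation q o σ

  ObsStrategy : Set
  ObsStrategy = History (Fin nO) (Fin nA) → Fin nA

  EveWinsDirFix : ℕ → Set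
  EveWinsDirFix ℓ = Σ ObsStrategy λ λE →
    ∀ o σ → IsPlay o σ → (∀ n → σ n ≡ λE (prefix o σ n)) → DirFix ℓ o σ

  -- The game G′, for ℓmax = suc k.  Index j ∈ {1..ℓmax} is Fin ℓmax
  -- (j = 1 ↔ zero).  A position f assigns to each state either ⊥
  -- (nothing) or a vector in ℤ^ℓmax.

  module G′ (k : ℕ) where
    ℓmax : ℕ
    ℓmax = suc k

    Pos : Set
    Pos = Vec (Maybe (Vec ℤ ℓmax)) nQ

    fI : Pos
    fI = tabulate λ q → if does (q ≟ qI) then just (replicate ℓmax (+ 0)) else nothing

    InPost : Fin nA → Pos → Fin nQ → Set
    InPost σ f q = ∃ λ p → is-just (lookup f p) ≡ true × Δ p σ q ≡ true

    -- minimum with +∞ represented by nothing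
    minM : Maybe ℤ → Maybe ℤ → Maybe ℤ
    minM nothing  y        = y
    minM (just x) nothing  = just x
    minM (just x) (just y) = just (x ⊓ℤ y)

    cand : Fin nA → Pos → Fin ℓmax → Fin nQ → Fin nQ → Maybe ℤ
    cand σ f zero q p =
      if is-just (lookup f p) ∧ Δ p σ q then just (w p σ q) else nothing
    cand σ f (suc j) q p with lookup f p
    ... | nothing = nothing
    ... | just v  = if Δ p σ q ∧ does (lookup v (inject₁ j) ℤ.<? + 0)
                      then just (lookup v (inject₁ j) +ℤ w p σ q) else nothing

    ζ : Fin nA → Pos → Fin ℓmax → Fin nQ → Maybe ℤ
    ζ σ f j q = foldr minM nothing (map (cand σ f j q) (allFin nQ))

    clamp : Maybe ℤ → ℤ
    clamp nothing  = + 0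
    clamp (just z) = (- (+ (maxW ℕ.* ℓmax))) ⊔ℤ (+ 0 ⊓ℤ z)

    IsSucc : Fin nA → Pos → Pos → Set
    IsSucc σ f₁ f₂ = ∃ λ (o : Fin nO) → ∀ q →
      ((InPost σ f₁ q × obs q ≡ o) →
          lookup f₂ q ≡ just (tabulate λ j → clamp (ζ σ f₁ j q)))
      × (¬ (InPost σ f₁ q × obs q ≡ o) → lookup f₂ q ≡ nothing)

    InU : Pos → Set
    InU f = ∃ λ q → ∃ λ v → lookup f q ≡ just v × last v <ℤ + 0

    Strategy′ : Set
    Strategy′ = History Pos (Fin nA) → Fin nA

    EveWinsSafety : Set
    EveWinsSafety = Σ Strategy′ λ τ →
      ∀ (f : ℕ → Pos) (σ : ℕ → Fin nA) →
        f 0 ≡ fI →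
        (∀ n → σ n ≡ τ (prefix f σ n)) →
        (∀ n → IsSucc (σ n) (f n) (f (suc n))) →
        ∀ n → ¬ InU (f n)

-- Eve plays in G by running the knowledge update of G′ on the observations she
-- receives: f_n(q) records, for every state q she may be in and every j ≤ ℓmax,
-- the least (clamped) weight of a window of length j ending in q all of whose
-- proper prefixes are negative.  Adam's choice of observation class in G′ is the
-- observation actually received, so every play consistent with this strategy
-- induces a play of G′ consistent with Eve's safe strategy there.  If a concrete
-- path had, from some i, only negative prefixes up to length ℓmax, then by
-- induction on the length the last counter of f_{i+ℓmax} at its current state
-- would be at most that negative weight (clamping at -W·ℓmax never interferes,
-- as such windows weigh at least -W·ℓmax), so the G′-play would enter 𝒰.
module Submission where

open import Defs
open import Data.Nat as ℕ using (ℕ; zero; suc; z≤n; s≤s)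
import Data.Nat.Properties as ℕP
open import Data.Integer as ℤ using (ℤ; +_; -_; ∣_∣; -[1+_]; +≤+; -≤-; -≤+)
import Data.Integer.Properties as ℤP
open import Data.Fin as Fin using (Fin; zero; suc; inject₁; fromℕ; toℕ)
import Data.Fin.Properties as FinP
open import Data.Bool as Bool using (true; if_then_else_)
open import Data.Maybe using (just; nothing; is-just)
open import Data.List using (List; []; _∷_; map; foldr; allFin; applyUpTo)
import Data.List.Properties as ListP
open import Data.List.Relation.Unary.Any using (here; there)
open import Data.List.Membership.Propositional using (_∈_; lose)
open import Data.List.Membership.Propositional.Properties using (∈-concatMap⁺; ∈-allFin; ∈-map⁺)
open import Data.Vec using (Vec; lookup; tabulate; last) renaming (_∷_ to _∷v_; [] to []v)
import Data.Vec.Properties as VecP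
open import Data.Product using (∃; _×_; _,_; proj₁; proj₂)
open import Data.Sum using (_⊎_; inj₁; inj₂; [_,_]′)
open import Data.Empty using (⊥-elim)
open import Relation.Nullary using (does; Dec; yes; no)
open import Relation.Nullary.Decidable using (_×-dec_; dec-true; dec-false)
open import Relation.Binary.PropositionalEquality using (_≡_; refl; sym; trans; cong; subst)
open import Function using (_∘_; id)

∈⇒≤foldr-⊔ : ∀ {x : ℕ} {xs} → x ∈ xs → x ℕ.≤ foldr ℕ._⊔_ 0 xs
∈⇒≤foldr-⊔ {xs = y ∷ ys} (here refl) = ℕP.m≤m⊔n y _
∈⇒≤foldr-⊔ {xs = y ∷ ys} (there x∈ys) =
  ℕP.≤-trans (∈⇒≤foldr-⊔ x∈ys) (ℕP.m≤n⊔m y _)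

∣i∣≤n⇒-n≤i : ∀ {n : ℕ} (i : ℤ) → ∣ i ∣ ℕ.≤ n → - (+ n) ℤ.≤ i
∣i∣≤n⇒-n≤i {zero}  (+ m)    _       = +≤+ z≤n
∣i∣≤n⇒-n≤i {suc n} (+ m)    _       = -≤+
∣i∣≤n⇒-n≤i {suc n} -[1+ m ] (s≤s h) = -≤- h

last≡lookup-fromℕ : ∀ {A : Set} {n} (v : Vec A (suc n)) → last v ≡ lookup v (fromℕ n)
last≡lookup-fromℕ (x ∷v []v)      = refl
last≡lookup-fromℕ (x ∷v y ∷v ys) = last≡lookup-fromℕ (y ∷v ys)

module Simulation (G : WGA) (k : ℕ) where
  open WGA G
  open G′ G k

  W : ℕ
  W = maxW G

  ∣w∣≤W : ∀ {p a q} → Δ p a q ≡ true → ∣ w p a q ∣ ℕ.≤ W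
  ∣w∣≤W {p} {a} {q} Δpaq = ∈⇒≤foldr-⊔
    (∈-concatMap⁺ _ (lose (∈-allFin p) (∈-concatMap⁺ _ (lose (∈-allFin a)
      (∈-concatMap⁺ _ (lose (∈-allFin q) listed))))))
    where
    listed : ∣ w p a q ∣ ∈ (if Δ p a q then ∣ w p a q ∣ ∷ [] else [])
    listed rewrite Δpaq = here refl

  inPost? : ∀ a f q → Dec (InPost a f q)
  inPost? a f q = FinP.any? (λ p → (is-just (lookup f p) Bool.≟ true) ×-dec (Δ p a q Bool.≟ true))

  counters : Fin nA → Pos → Fin nQ → Vec ℤ ℓmax
  counters a f q = tabulate λ j → clamp (ζ a f j q)

  step : Fin nA → Pos → Fin nO → Pos
  step a f o = tabulate λ q →
    if does (inPost? a f q ×-dec (obs q Fin.≟ o)) then just (counters a f q) else nothing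

  step-isSucc : ∀ a f o → IsSucc a f (step a f o)
  step-isSucc a f o = o , λ q →
    let branch = if_then just (counters a f q) else nothing
        q∈post? = inPost? a f q ×-dec (obs q Fin.≟ o)
    in (λ h → trans (VecP.lookup∘tabulate _ q) (cong branch (dec-true q∈post? h)))
     , (λ h → trans (VecP.lookup∘tabulate _ q) (cong branch (dec-false q∈post? h)))

  step-lookup : ∀ a f o {q} → InPost a f q → obs q ≡ o →
                lookup (step a f o) q ≡ just (counters a f q)
  step-lookup a f o {q} q∈post obsq = proj₁ (proj₂ (step-isSucc a f o) q) (q∈post , obsq)

  run : Pos → (ℕ → Fin nO) → (ℕ → Fin nA) → ℕ → Pos
  run f o σ zero    = f
  run f o σ (suc n) = run (step (σ 0) f (o 1)) (o ∘ suc) (σ ∘ suc) n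

  run-suc : ∀ f o σ n → run f o σ (suc n) ≡ step (σ n) (run f o σ n) (o (suc n))
  run-suc f o σ zero    = refl
  run-suc f o σ (suc n) = run-suc (step (σ 0) f (o 1)) (o ∘ suc) (σ ∘ suc) n

  run-isSucc : ∀ f o σ n → IsSucc (σ n) (run f o σ n) (run f o σ (suc n))
  run-isSucc f o σ n = subst (IsSucc (σ n) (run f o σ n)) (sym (run-suc f o σ n))
                             (step-isSucc (σ n) (run f o σ n) (o (suc n)))

  -- The update after action σᵢ needs the next observation oᵢ₊₁, found in the
  -- next pair of the history or, at its end, in the current observation.
  nextObs : List (Fin nO × Fin nA) → Fin nO → Fin nO
  nextObs []             o = o
  nextObs ((o′ , _) ∷ _) _ = o′

  translate : Pos → History G (Fin nO) (Fin nA) → History G Pos (Fin nA)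
  translate f ([] , o)          = [] , f
  translate f ((_ , a) ∷ h , o) =
    let h′ = translate (step a f (nextObs h o)) (h , o) in (f , a) ∷ proj₁ h′ , proj₂ h′

  nextObs-applyUpTo : ∀ (o : ℕ → Fin nO) (σ : ℕ → Fin nA) n →
                      nextObs (applyUpTo (λ i → o i , σ i) n) (o n) ≡ o 0
  nextObs-applyUpTo o σ zero    = refl
  nextObs-applyUpTo o σ (suc n) = refl

  translate-applyUpTo : ∀ f o σ n → translate f (applyUpTo (λ i → o i , σ i) n , o n)
                                    ≡ (applyUpTo (λ i → run f o σ i , σ i) n , run f o σ n)
  translate-applyUpTo f o σ zero = refl
  translate-applyUpTo f o σ (suc n)
    rewrite nextObs-applyUpTo (o ∘ suc) (σ ∘ suc) n
          | translate-applyUpTo (step (σ 0) f (o 1)) (o ∘ suc) (σ ∘ suc) n = refl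

  translate-prefix : ∀ f o σ n → translate f (prefix G o σ n) ≡ prefix G (run f o σ) σ n
  translate-prefix f o σ n
    rewrite ListP.map-upTo (λ i → o i , σ i) n
          | ListP.map-upTo (λ i → run f o σ i , σ i) n = translate-applyUpTo f o σ n

  minM-≤ˡ : ∀ c y → ∃ λ z → minM (just c) y ≡ just z × z ℤ.≤ c
  minM-≤ˡ c nothing  = c , refl , ℤP.≤-refl
  minM-≤ˡ c (just y) = c ℤ.⊓ y , refl , ℤP.i⊓j≤i c y

  minM-≤ʳ : ∀ x c → ∃ λ z → minM x (just c) ≡ just z × z ℤ.≤ c
  minM-≤ʳ nothing  c = c , refl , ℤP.≤-refl
  minM-≤ʳ (just x) c = x ℤ.⊓ c , refl , ℤP.i⊓j≤j x c

  foldr-minM-≤ : ∀ {c} ys → just c ∈ ys → ∃ λ z → foldr minM nothing ys ≡ just z × z ℤ.≤ c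
  foldr-minM-≤ {c} (y ∷ ys) (here refl) = minM-≤ˡ c (foldr minM nothing ys)
  foldr-minM-≤ (y ∷ ys) (there c∈ys) with foldr minM nothing ys | foldr-minM-≤ ys c∈ys
  ... | .(just z) | z , refl , z≤c with minM-≤ʳ y z
  ... | z′ , eq , z′≤z = z′ , eq , ℤP.≤-trans z′≤z z≤c

  -Wℓmax : ℤ
  -Wℓmax = - (+ (W ℕ.* ℓmax))

  counters-≤ : ∀ a f j q {p c s} → cand a f j q p ≡ just c → c ℤ.≤ s → -Wℓmax ℤ.≤ s →
               lookup (counters a f q) j ℤ.≤ s
  counters-≤ a f j q {p} cand≡c c≤s -Wℓmax≤s
    with foldr-minM-≤ _ (subst (_∈ map (cand a f j q) (allFin nQ)) cand≡c
                               (∈-map⁺ (cand a f j q) (∈-allFin p)))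
  ... | z , ζ≡z , z≤c rewrite VecP.lookup∘tabulate (λ j → clamp (ζ a f j q)) j | ζ≡z =
    ℤP.⊔-lub -Wℓmax≤s (ℤP.≤-trans (ℤP.i⊓j≤j (+ 0) z) (ℤP.≤-trans z≤c c≤s))

  cand-zero : ∀ a f q p → is-just (lookup f p) ≡ true → Δ p a q ≡ true →
              cand a f zero q p ≡ just (w p a q)
  cand-zero a f q p p∈supp Δpaq rewrite p∈supp | Δpaq = refl

  cand-suc : ∀ a f q p {v} (t : Fin k) → lookup f p ≡ just v → Δ p a q ≡ true →
             lookup v (inject₁ t) ℤ.< + 0 →
             cand a f (suc t) q p ≡ just (lookup v (inject₁ t) ℤ.+ w p a q)
  cand-suc a f q p {v} t fp≡v Δpaq neg with lookup f p | fp≡v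
  ... | .(just v) | refl rewrite Δpaq | dec-true (lookup v (inject₁ t) ℤP.<? + 0) neg = refl

  module Path (o : ℕ → Fin nO) (σ : ℕ → Fin nA) (q : ℕ → Fin nQ)
              (path : IsConcretePath G q σ) (obs≡o : ∀ i → obs (q i) ≡ o i) (o0 : o 0 ≡ obs qI) where

    F : ℕ → Pos
    F = run fI o σ

    seg : ℕ → ℕ → ℤ
    seg = segWeight G q σ

    segWeight≥-jW : ∀ i j → - (+ (j ℕ.* W)) ℤ.≤ seg i j
    segWeight≥-jW i zero    = ℤP.≤-refl
    segWeight≥-jW i (suc j) = subst (ℤ._≤ seg i (suc j)) (sym split)
      (ℤP.+-mono-≤ (segWeight≥-jW i j) (∣i∣≤n⇒-n≤i _ (∣w∣≤W (path (i ℕ.+ j)))))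
      where
      split : - (+ (suc j ℕ.* W)) ≡ - (+ (j ℕ.* W)) ℤ.+ - (+ W)
      split = trans (cong -_ (ℤP.pos-+ W (j ℕ.* W)))
                (trans (ℤP.neg-distrib-+ (+ W) (+ (j ℕ.* W))) (ℤP.+-comm (- (+ W)) _))

    segWeight≥ : ∀ i j → j ℕ.≤ ℓmax → -Wℓmax ℤ.≤ seg i j
    segWeight≥ i j j≤ℓ = ℤP.≤-trans
      (subst (λ x → - (+ x) ℤ.≤ - (+ (j ℕ.* W))) (ℕP.*-comm ℓmax W)
         (ℤP.neg-mono-≤ (+≤+ (ℕP.*-monoˡ-≤ W j≤ℓ))))
      (segWeight≥-jW i j)

    F-lookup-suc : ∀ n {v} → lookup (F n) (q n) ≡ just v →
                   lookup (F (suc n)) (q (suc n)) ≡ just (counters (σ n) (F n) (q (suc n)))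
    F-lookup-suc n Fn≡v rewrite run-suc fI o σ n =
      step-lookup (σ n) (F n) (o (suc n)) (q n , cong is-just Fn≡v , path n) (obs≡o (suc n))

    q∈supp : ∀ n → ∃ λ v → lookup (F n) (q n) ≡ just v
    q∈supp zero = _ , trans (VecP.lookup∘tabulate _ (q 0))
      (cong (if_then _ else nothing) (dec-true (q 0 Fin.≟ qI) (qI-alone (q 0) (trans (obs≡o 0) o0))))
    q∈supp (suc n) = _ , F-lookup-suc n (proj₂ (q∈supp n))

    CounterBound : ℕ → Fin ℓmax → ℤ → Set
    CounterBound n t s = ∃ λ v → lookup (F n) (q n) ≡ just v × lookup v t ℤ.≤ s

    stepWeight : ℕ → ℤ
    stepWeight n = w (q n) (σ n) (q (suc n))

    counter-start : ∀ n {s} → stepWeight n ℤ.≤ s → -Wℓmax ℤ.≤ s → CounterBound (suc n) zero s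
    counter-start n w≤s -Wℓmax≤s = _ , F-lookup-suc n Fn≡v ,
      counters-≤ (σ n) (F n) zero (q (suc n))
        (cand-zero (σ n) (F n) (q (suc n)) (q n) (cong is-just Fn≡v) (path n)) w≤s -Wℓmax≤s
      where Fn≡v = proj₂ (q∈supp n)

    counter-step : ∀ n {t : Fin k} {s} → CounterBound n (inject₁ t) s → s ℤ.< + 0 →
                   -Wℓmax ℤ.≤ s ℤ.+ stepWeight n → CounterBound (suc n) (suc t) (s ℤ.+ stepWeight n)
    counter-step n {t} (v , Fn≡v , vt≤s) s<0 -Wℓmax≤s′ = _ , F-lookup-suc n Fn≡v ,
      counters-≤ (σ n) (F n) (suc t) (q (suc n))
        (cand-suc (σ n) (F n) (q (suc n)) (q n) t Fn≡v (path n) (ℤP.≤-<-trans vt≤s s<0))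
        (ℤP.+-monoˡ-≤ _ vt≤s) -Wℓmax≤s′

    NegativeWindows : ℕ → ℕ → Set
    NegativeWindows i L = ∀ n → n ℕ.< L → seg i (suc n) ℤ.< + 0

    GW⊎NegativeWindows : ∀ i L → GW G q σ i L ⊎ NegativeWindows i L
    GW⊎NegativeWindows i L with ℕP.anyUpTo? (λ n → + 0 ℤP.≤? seg i (suc n)) L
    ... | yes (n , n<L , nonneg) = inj₁ (suc n , s≤s z≤n , n<L , nonneg)
    ... | no none = inj₂ λ n n<L → ℤP.≰⇒> λ nonneg → none (n , n<L , nonneg)

    -- Induction on m = toℕ t, since inject₁ t is not a structural subterm of suc t.
    counter≤segWeight : ∀ m (t : Fin ℓmax) → toℕ t ≡ m → ∀ i → NegativeWindows i (suc m) →
                        CounterBound (i ℕ.+ suc m) t (seg i (suc m))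
    counter≤segWeight zero zero _ i _ =
      subst (λ n → CounterBound n zero (seg i 1)) (sym (ℕP.+-suc i 0))
        (counter-start (i ℕ.+ 0) (ℤP.≤-reflexive (sym (ℤP.+-identityˡ _))) (segWeight≥ i 1 (s≤s z≤n)))
    counter≤segWeight zero    (suc t) () i neg
    counter≤segWeight (suc m) zero    () i neg
    counter≤segWeight (suc m) (suc t) t≡m i neg =
      subst (λ n → CounterBound n (suc t) (seg i (suc (suc m)))) (sym (ℕP.+-suc i (suc m)))
        (counter-step (i ℕ.+ suc m) shorter (neg m (ℕP.n≤1+n _))
                      (segWeight≥ i (suc (suc m)) window≤ℓ))
      where
      shorter : CounterBound (i ℕ.+ suc m) (inject₁ t) (seg i (suc m))
      shorter = counter≤segWeight m (inject₁ t) (trans (FinP.toℕ-inject₁ t) (ℕP.suc-injective t≡m)) i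
                  (λ n n<1+m → neg n (ℕP.m≤n⇒m≤1+n n<1+m))
      window≤ℓ : suc (suc m) ℕ.≤ ℓmax
      window≤ℓ = subst (λ x → suc x ℕ.≤ ℓmax) t≡m (FinP.toℕ<n (suc t))

    negativeWindows⇒unsafe : ∀ i → NegativeWindows i ℓmax → InU (F (i ℕ.+ ℓmax))
    negativeWindows⇒unsafe i neg with counter≤segWeight k (fromℕ k) (FinP.toℕ-fromℕ k) i neg
    ... | v , F≡v , v≤seg = q (i ℕ.+ ℓmax) , v , F≡v ,
      subst (ℤ._< + 0) (sym (last≡lookup-fromℕ v)) (ℤP.≤-<-trans v≤seg (neg k ℕP.≤-refl))

lemma5 : (G : WGA) (k : ℕ) → G′.EveWinsSafety G k → EveWinsDirFix G (suc k)
lemma5 G k (τ , safe) = λE , winning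
  where
  open G′ G k
  open Simulation G k

  λE : ObsStrategy G
  λE h = τ (translate fI h)

  winning : ∀ o σ → IsPlay G o σ → (∀ n → σ n ≡ λE (prefix G o σ n)) → DirFix G (suc k) o σ
  winning o σ (o0 , _) consistent q (path , obs≡o) i =
    [ id , negativeWindows⇒GW ]′ (GW⊎NegativeWindows i ℓmax)
    where
    open Path o σ q path obs≡o o0
    negativeWindows⇒GW : NegativeWindows i ℓmax → GW G q σ i ℓmax
    negativeWindows⇒GW neg = ⊥-elim (safe F σ refl
      (λ n → trans (consistent n) (cong τ (translate-prefix fI o σ n)))
      (run-isSucc fI o σ) (i ℕ.+ ℓmax) (negativeWindows⇒unsafe i neg))
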